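{- Let $q$ be a prime power, $F_q$ the field with $q$ elements, $V=F_q^n$, and $1<k<n-1$. Let $S$ be a $(k-1)$-dimensional subspace of $V$ having generator matrix $M=[I_{k-1}\ A]=[I_{k-1}\ l_1\ l_2\ \cdots\ l_{n-k+1}]$, where $I_{k-1}$ is the $(k-1)\times(k-1)$ identity matrix and $l_1,\dots,l_{n-k+1}$ are the columns of the $(k-1)\times(n-k+1)$ matrix $A$. For a permutation $\sigma$ of $\{1,\dots,n-k+1\}$ let $S_\sigma$ be the code with generator matrix $[I_{k-1}\ l_{\sigma(1)}\ \cdots\ l_{\sigma(n-k+1)}]$. Then $[S\rangle^{\Pi}_{k}$ is a star of $\Pi[n,k]_q$ if and only if $[S_\sigma\rangle^{\Pi}_{k}$ is a star of $\Pi[n,k]_q$ for every such permutation $\sigma$.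
   Context: A linear code $[n,k]_q$ is a $k$-dimensional subspace of $V=F_q^n$; a generator matrix is a matrix whose rows form a basis of it. A code is projective if the columns of a generator matrix are non-zero and pairwise non-proportional. $\Pi(n,k)_q$ denotes the set of all $k$-dimensional projective codes in $V$, and $\Pi[n,k]_q$ is the simple graph with vertex set $\Pi(n,k)_q$ in which two distinct codes are adjacent iff their intersection is $(k-1)$-dimensional. A clique is a set of pairwise adjacent vertices; it is maximal if not properly contained in another clique. $[S\rangle^{\Pi}_{k}$ denotes the set of all elements of $\Pi(n,k)_q$ containing $S$; it is called a star of $\Pi[n,k]_q$ if it is a maximal clique of $\Pi[n,k]_q$. -}

module Defs where

open import Level using (Level; _⊔_) renaming (suc to lsuc)
open import Data.Nat using (ℕ; zero; suc; _≤_; _^_) renaming (_+_ to _+ℕ_; _∸_ to _∸ℕ_)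
open import Data.Nat.Primality using (Prime)
open import Data.Fin using (Fin; zero; suc; _≟_)
open import Data.Product using (Σ; ∃; ∃-syntax; _×_; _,_)
open import Data.Bool using (if_then_else_)
open import Data.Vec.Functional using (_++_)
open import Relation.Nullary using (¬_; ⌊_⌋)
open import Relation.Binary using (Decidable)
open import Relation.Binary.PropositionalEquality using (_≡_; _≢_)
open import Function.Bundles using (_⇔_)
open import Algebra.Bundles using (CommutativeRing)

IsPrimePower : ℕ → Set
IsPrimePower q = Σ ℕ λ p → Σ ℕ λ e → Prime p × 1 ≤ e × q ≡ p ^ e

record FiniteField (c ℓ : Level) (q : ℕ) : Set (lsuc (c ⊔ ℓ)) where
  field
    commutativeRing : CommutativeRing c ℓ
  open CommutativeRing commutativeRing public
  field
    1≉0       : ¬ (1# ≈ 0#)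
    inverse   : ∀ x → ¬ (x ≈ 0#) → ∃ λ y → x * y ≈ 1#
    _≈?_      : Decidable _≈_
    enum      : Fin q → Carrier
    enum-surj : ∀ x → ∃ λ i → enum i ≈ x
    enum-inj  : ∀ i j → enum i ≈ enum j → i ≡ j

module LinAlg {c ℓ : Level} {q : ℕ} (F : FiniteField c ℓ q) where
  open FiniteField F using (Carrier; _≈_; _+_; _*_; 0#; 1#)

  Vect : ℕ → Set c
  Vect n = Fin n → Carrier

  Subset : ℕ → Set (lsuc (c ⊔ ℓ))
  Subset n = Vect n → Set (c ⊔ ℓ)

  sumF : ∀ {m} → (Fin m → Carrier) → Carrier
  sumF {zero}  f = 0#
  sumF {suc m} f = f zero + sumF (λ i → f (suc i))

  lincomb : ∀ {m n} → (Fin m → Carrier) → (Fin m → Vect n) → Vect n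
  lincomb a g j = sumF (λ i → a i * g i j)

  Span : ∀ {m n} → (Fin m → Vect n) → Subset n
  Span g v = ∃ λ a → ∀ j → v j ≈ lincomb a g j

  LinIndep : ∀ {m n} → (Fin m → Vect n) → Set (c ⊔ ℓ)
  LinIndep g = ∀ a → (∀ j → lincomb a g j ≈ 0#) → ∀ i → a i ≈ 0#

  IsGenMatrix : ∀ {m n} → Subset n → (Fin m → Vect n) → Set (c ⊔ ℓ)
  IsGenMatrix P g = LinIndep g × (∀ v → P v ⇔ Span g v)

  HasDim : ∀ {n} → Subset n → ℕ → Set (c ⊔ ℓ)
  HasDim {n} P m = Σ (Fin m → Vect n) λ g → IsGenMatrix P g

  ProjectiveColumns : ∀ {m n} → (Fin m → Vect n) → Set (c ⊔ ℓ)
  ProjectiveColumns g =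
    (∀ j → ¬ (∀ i → g i j ≈ 0#)) ×
    (∀ j j′ → j ≢ j′ → ¬ (∃ λ a → ∀ i → g i j ≈ a * g i j′))

  IsProjectiveCode : ∀ {n} → ℕ → Subset n → Set (c ⊔ ℓ)
  IsProjectiveCode {n} k P =
    HasDim P k × (Σ (Fin k → Vect n) λ g → IsGenMatrix P g × ProjectiveColumns g)

  Π : ℕ → ℕ → Set (lsuc (c ⊔ ℓ))
  Π n k = Σ (Subset n) (IsProjectiveCode k)

  code : ∀ {n k} → Π n k → Subset n
  code (P , _) = P

  SameCode : ∀ {n k} → Π n k → Π n k → Set (c ⊔ ℓ)
  SameCode C D = ∀ v → code C v ⇔ code D v

  Adjacent : ∀ {n k} → Π n k → Π n k → Set (c ⊔ ℓ)
  Adjacent {n} {k} C D =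
    ¬ SameCode C D × HasDim (λ v → code C v × code D v) (k ∸ℕ 1)

  VertexSet : ℕ → ℕ → Set (lsuc (c ⊔ ℓ))
  VertexSet n k = Π n k → Set (c ⊔ ℓ)

  IsClique : ∀ {n k} → VertexSet n k → Set (lsuc (c ⊔ ℓ))
  IsClique X = ∀ C D → X C → X D → ¬ SameCode C D → Adjacent C D

  IsMaximalClique : ∀ {n k} → VertexSet n k → Set (lsuc (c ⊔ ℓ))
  IsMaximalClique {n} {k} X =
    IsClique X × (∀ (Y : VertexSet n k) → IsClique Y → (∀ C → X C → Y C) → ∀ C → Y C → X C)

  StarSet : ∀ {n} → (k : ℕ) → Subset n → VertexSet n k
  StarSet k S C = ∀ v → S v → code C v

  IsStar : ∀ {n} → (k : ℕ) → Subset n → Set (lsuc (c ⊔ ℓ))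
  IsStar k S = IsMaximalClique (StarSet k S)

  idRow : ∀ {m} → Fin m → Vect m
  idRow i a = if ⌊ i ≟ a ⌋ then 1# else 0#

  genM : ∀ {m r} → (Fin m → Fin r → Carrier) → Fin m → Vect (m +ℕ r)
  genM A i = idRow i ++ A i

-- A permutation ρ of the coordinates acts on F_q^n by v ↦ v ∘ ρ. It carries generator
-- matrices, linear independence, projective columns and dimensions of intersections
-- along, and ρ⁻¹ undoes it, so it induces an automorphism of the graph Π[n,k]_q, which
-- maps the maximal clique [S⟩ onto [ρS⟩. As [I A_σ] is [I A] with its columns permuted
-- by id ⊎ σ, S_σ = ρS; the converse is the case σ = id.
module Submission where

open import Defs
open import Level using (Level; _⊔_) renaming (suc to lsuc)
open import Data.Nat using (ℕ; suc; _+_; _∸_; _<_)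
open import Data.Fin using (Fin; zero; suc; splitAt; join)
open import Data.Fin.Properties using (+↔⊎; splitAt-join)
open import Data.Fin.Permutation using (Permutation′; _⟨$⟩ʳ_; _⟨$⟩ˡ_; inverseʳ; inverseˡ; flip)
import Data.Fin.Permutation as Perm
open import Data.Product using (_×_; _,_)
open import Data.Product.Base using (swap; map)
open import Data.Sum using (_⊎_; inj₁; inj₂; [_,_])
import Data.Sum as Sum
open import Data.Sum.Properties using ([,]-map)
open import Data.Sum.Function.Propositional using (_⊎-↔_)
open import Data.Empty using (⊥-elim)
open import Function using (_∘_; id; Injective; Injection)
open import Function.Bundles using (_⇔_; mk⇔; Equivalence)
open import Function.Properties.Inverse using (↔-refl; ↔-sym; ↔-trans; ↔⇒↣)
open import Relation.Nullary using (¬_)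
open import Relation.Binary.Bundles using (Setoid)
import Relation.Binary.Reasoning.Setoid as SetoidReasoning
open import Relation.Binary.PropositionalEquality
  using (_≡_; _≗_; refl; sym; cong; cong₂; subst; subst₂; module ≡-Reasoning)

module _ {c ℓ : Level} {q : ℕ} (F : FiniteField c ℓ q) where
  open FiniteField F using (Carrier; _≈_; _*_; 0#) renaming (_+_ to _+ᶠ_)
  open LinAlg F
  open Equivalence using (to; from)

  private variable
    m n k d : ℕ

  sumF-cong : {f h : Fin m → Carrier} → (∀ i → f i ≡ h i) → sumF f ≡ sumF h
  sumF-cong {m = ℕ.zero} e = refl
  sumF-cong {m = suc m} e = cong₂ _+ᶠ_ (e zero) (sumF-cong (e ∘ suc))

  Span-cong : {g g′ : Fin m → Vect n} {u v : Vect n} →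
              (∀ i j → g i j ≡ g′ i j) → u ≗ v → Span g u → Span g′ v
  Span-cong eg euv (a , h) = a , λ j →
    subst₂ _≈_ (euv j) (sumF-cong λ i → cong (a i *_) (eg i j)) (h j)

  Span-reindex : ∀ {n′} {g : Fin m → Vect n} {v : Vect n} (τ : Fin n′ → Fin n) →
                 Span g v → Span (λ i → g i ∘ τ) (v ∘ τ)
  Span-reindex τ (a , h) = a , h ∘ τ

  ProjectiveColumns-reindex : ∀ {n′} {g : Fin m → Vect n} {τ : Fin n′ → Fin n} →
                              Injective _≡_ _≡_ τ →
                              ProjectiveColumns g → ProjectiveColumns (λ i → g i ∘ τ)
  ProjectiveColumns-reindex τ-inj (nonzero , unproportional) =
    nonzero ∘ _ , λ j j′ j≢j′ → unproportional _ _ (j≢j′ ∘ τ-inj)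

  permuteᵛ : Permutation′ n → Vect n → Vect n
  permuteᵛ ρ v = v ∘ (ρ ⟨$⟩ʳ_)

  permuteˢ : Permutation′ n → Subset n → Subset n
  permuteˢ ρ P = P ∘ permuteᵛ (flip ρ)

  -- S′ is permuteˢ ρ S, up to closing either set under ≗.
  IsImage : Permutation′ n → Subset n → Subset n → Set (c ⊔ ℓ)
  IsImage ρ S S′ = (∀ u → S u → S′ (permuteᵛ ρ u)) × (∀ v → S′ v → S (permuteᵛ (flip ρ) v))

  Span-permute : {g : Fin m → Vect n} {v : Vect n} (ρ : Permutation′ n) →
                 Span (permuteᵛ ρ ∘ g) v ⇔ Span g (permuteᵛ (flip ρ) v)
  Span-permute {g = g} {v} ρ = mk⇔
    (Span-cong (λ i j → cong (g i) (inverseʳ ρ)) (λ _ → refl) ∘ Span-reindex (ρ ⟨$⟩ˡ_))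
    (Span-cong (λ _ _ → refl) (λ j → cong v (inverseˡ ρ)) ∘ Span-reindex (ρ ⟨$⟩ʳ_))

  Span-image : {g g′ : Fin m → Vect n} (ρ : Permutation′ n) →
               (∀ i → g′ i ≗ permuteᵛ ρ (g i)) → IsImage ρ (Span g) (Span g′)
  Span-image {g = g} {g′} ρ g′≗ρg = image , preimage
    where
    image : ∀ u → Span g u → Span g′ (permuteᵛ ρ u)
    image u = Span-cong (λ i j → sym (g′≗ρg i j)) (λ _ → refl) ∘ Span-reindex (ρ ⟨$⟩ʳ_)

    preimage : ∀ v → Span g′ v → Span g (permuteᵛ (flip ρ) v)
    preimage v = to (Span-permute ρ) ∘ Span-cong g′≗ρg (λ _ → refl)

  LinIndep-permute : {g : Fin m → Vect n} (ρ : Permutation′ n) →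
                     LinIndep g → LinIndep (permuteᵛ ρ ∘ g)
  LinIndep-permute {g = g} ρ indep a h =
    indep a λ j → subst (λ j′ → lincomb a g j′ ≈ 0#) (inverseʳ ρ) (h (ρ ⟨$⟩ˡ j))

  IsGenMatrix-permute : {P : Subset n} {g : Fin m → Vect n} (ρ : Permutation′ n) →
                        IsGenMatrix P g → IsGenMatrix (permuteˢ ρ P) (permuteᵛ ρ ∘ g)
  IsGenMatrix-permute ρ (indep , spans) =
    LinIndep-permute ρ indep ,
    λ v → mk⇔ (from (Span-permute ρ) ∘ to (spans _)) (from (spans _) ∘ to (Span-permute ρ))

  HasDim-permute : {P : Subset n} (ρ : Permutation′ n) → HasDim P d → HasDim (permuteˢ ρ P) d
  HasDim-permute ρ (g , gen) = permuteᵛ ρ ∘ g , IsGenMatrix-permute ρ gen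

  permuteCode : Permutation′ n → Π n k → Π n k
  permuteCode ρ (P , dim , g , gen , proj) =
    permuteˢ ρ P , HasDim-permute ρ dim , permuteᵛ ρ ∘ g , IsGenMatrix-permute ρ gen ,
    ProjectiveColumns-reindex (Injection.injective (↔⇒↣ ρ)) proj

  code-cong : (C : Π n k) {u v : Vect n} → u ≗ v → code C u → code C v
  code-cong (P , (g , _ , spans) , _) u≗v =
    from (spans _) ∘ Span-cong (λ _ _ → refl) u≗v ∘ to (spans _)

  HasDim-cong : {P Q : Subset n} → (∀ v → P v ⇔ Q v) → HasDim P d → HasDim Q d
  HasDim-cong P⇔Q (g , indep , spans) =
    g , indep , λ v → mk⇔ (to (spans v) ∘ from (P⇔Q v)) (to (P⇔Q v) ∘ from (spans v))

  module _ {n k : ℕ} where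

    SameCode-refl : (C : Π n k) → SameCode C C
    SameCode-refl C v = mk⇔ id id

    SameCode-sym : (C D : Π n k) → SameCode C D → SameCode D C
    SameCode-sym C D C≈D v = mk⇔ (from (C≈D v)) (to (C≈D v))

    SameCode-setoid : Setoid (lsuc (c ⊔ ℓ)) (c ⊔ ℓ)
    SameCode-setoid = record
      { Carrier       = Π n k
      ; _≈_           = SameCode
      ; isEquivalence = record
        { refl  = λ {C} → SameCode-refl C
        ; sym   = λ {C} {D} → SameCode-sym C D
        ; trans = λ C≈D D≈E v → mk⇔ (to (D≈E v) ∘ to (C≈D v)) (from (C≈D v) ∘ from (D≈E v))
        }
      }

    open SetoidReasoning SameCode-setoid

    Adjacent-sym : (C D : Π n k) → Adjacent C D → Adjacent D C
    Adjacent-sym C D (C≉D , meet) =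
      C≉D ∘ SameCode-sym D C , HasDim-cong (λ v → mk⇔ swap swap) meet

    Adjacent-resp : (C C′ D D′ : Π n k) → SameCode C C′ → SameCode D D′ →
                    Adjacent C D → Adjacent C′ D′
    Adjacent-resp C C′ D D′ C≈C′ D≈D′ (C≉D , meet) =
      (λ C′≈D′ → C≉D (begin C ≈⟨ C≈C′ ⟩ C′ ≈⟨ C′≈D′ ⟩ D′ ≈⟨ D≈D′ ⟨ D ∎)) ,
      HasDim-cong (λ v → mk⇔ (map (to (C≈C′ v)) (to (D≈D′ v)))
                             (map (from (C≈C′ v)) (from (D≈D′ v)))) meet

    permuteCode-flip : (ρ : Permutation′ n) (C : Π n k) →
                       SameCode (permuteCode (flip ρ) (permuteCode ρ C)) C
    permuteCode-flip ρ C v =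
      mk⇔ (code-cong C λ j → cong v (inverseʳ ρ)) (code-cong C λ j → sym (cong v (inverseʳ ρ)))

    permuteCode-cong : (ρ : Permutation′ n) (C D : Π n k) →
                       SameCode C D → SameCode (permuteCode ρ C) (permuteCode ρ D)
    permuteCode-cong ρ C D C≈D v = C≈D (permuteᵛ (flip ρ) v)

    permuteCode-reflects : (ρ : Permutation′ n) (C D : Π n k) →
                           SameCode (permuteCode ρ C) (permuteCode ρ D) → SameCode C D
    permuteCode-reflects ρ C D πC≈πD = begin
      C           ≈⟨ permuteCode-flip ρ C ⟨
      π⁻¹ (π C)   ≈⟨ permuteCode-cong (flip ρ) (π C) (π D) πC≈πD ⟩
      π⁻¹ (π D)   ≈⟨ permuteCode-flip ρ D ⟩
      D           ∎
      where
      π π⁻¹ : Π n k → Π n k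
      π = permuteCode ρ
      π⁻¹ = permuteCode (flip ρ)

    Adjacent-permute : (ρ : Permutation′ n) (C D : Π n k) →
                       Adjacent C D → Adjacent (permuteCode ρ C) (permuteCode ρ D)
    Adjacent-permute ρ C D (C≉D , meet) =
      C≉D ∘ permuteCode-reflects ρ C D , HasDim-permute ρ meet

    IsClique-preimage : (ρ : Permutation′ n) {X : VertexSet n k} →
                        IsClique X → IsClique (X ∘ permuteCode ρ)
    IsClique-preimage ρ clique C D x y C≉D =
      Adjacent-resp (π⁻¹ (π C)) C (π⁻¹ (π D)) D (permuteCode-flip ρ C) (permuteCode-flip ρ D)
        (Adjacent-permute (flip ρ) (π C) (π D)
          (clique (π C) (π D) x y (C≉D ∘ permuteCode-reflects ρ C D)))
      where
      π π⁻¹ : Π n k → Π n k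
      π = permuteCode ρ
      π⁻¹ = permuteCode (flip ρ)

    IsClique-∪-class : {X : VertexSet n k} (E : Π n k) → IsClique X →
                       (∀ C → X C → ¬ SameCode C E → Adjacent C E) →
                       IsClique (λ C → X C ⊎ SameCode C E)
    IsClique-∪-class {X} E clique adjacent = clique′
      where
      adjacent-class : ∀ C D → X C → SameCode D E → ¬ SameCode C D → Adjacent C D
      adjacent-class C D x D≈E C≉D =
        Adjacent-resp C C E D (SameCode-refl C) (SameCode-sym D E D≈E)
          (adjacent C x λ C≈E → C≉D (begin C ≈⟨ C≈E ⟩ E ≈⟨ D≈E ⟨ D ∎))

      clique′ : IsClique (λ C → X C ⊎ SameCode C E)
      clique′ C D (inj₁ x) (inj₁ y) C≉D = clique C D x y C≉D
      clique′ C D (inj₁ x) (inj₂ D≈E) C≉D = adjacent-class C D x D≈E C≉D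
      clique′ C D (inj₂ C≈E) (inj₁ y) C≉D =
        Adjacent-sym D C (adjacent-class D C y C≈E (C≉D ∘ SameCode-sym D C))
      clique′ C D (inj₂ C≈E) (inj₂ D≈E) C≉D = ⊥-elim (C≉D (begin C ≈⟨ C≈E ⟩ E ≈⟨ D≈E ⟨ D ∎))

    IsMaximalClique-cong : {X X′ : VertexSet n k} → (∀ C → X C ⇔ X′ C) →
                           IsMaximalClique X → IsMaximalClique X′
    IsMaximalClique-cong X⇔X′ (clique , maximal) =
      (λ C D x y → clique C D (from (X⇔X′ C) x) (from (X⇔X′ D) y)) ,
      λ Y cliqueY X′⊆Y C y →
        to (X⇔X′ C) (maximal Y cliqueY (λ D x → X′⊆Y D (to (X⇔X′ D) x)) C y)

    -- The class of π⁻¹ D is adjoined to X because Y itself need not be closed under SameCode.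
    IsMaximalClique-preimage : (ρ : Permutation′ n) {X : VertexSet n k} →
                               (∀ C D → SameCode C D → X D → X C) →
                               IsMaximalClique X → IsMaximalClique (X ∘ permuteCode (flip ρ))
    IsMaximalClique-preimage ρ {X} X-resp (clique , maximal) =
      IsClique-preimage (flip ρ) clique , maximal′
      where
      π π⁻¹ : Π n k → Π n k
      π = permuteCode ρ
      π⁻¹ = permuteCode (flip ρ)

      maximal′ : ∀ Y → IsClique Y → (∀ C → X (π⁻¹ C) → Y C) → ∀ D → Y D → X (π⁻¹ D)
      maximal′ Y cliqueY π⁻¹X⊆Y D y =
        maximal (λ C → Y (π C) ⊎ SameCode C (π⁻¹ D))
                (IsClique-∪-class (π⁻¹ D) (IsClique-preimage ρ cliqueY) adjacent)
                (λ C x → inj₁ (π⁻¹X⊆Y (π C) (X-resp (π⁻¹ (π C)) C (permuteCode-flip ρ C) x)))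
                (π⁻¹ D) (inj₂ (SameCode-refl (π⁻¹ D)))
        where
        adjacent : ∀ C → Y (π C) → ¬ SameCode C (π⁻¹ D) → Adjacent C (π⁻¹ D)
        adjacent C yπC C≉π⁻¹D =
          Adjacent-resp (π⁻¹ (π C)) C (π⁻¹ D) (π⁻¹ D)
            (permuteCode-flip ρ C) (SameCode-refl (π⁻¹ D))
            (Adjacent-permute (flip ρ) (π C) D (cliqueY (π C) D yπC y λ πC≈D →
              C≉π⁻¹D (begin
                C           ≈⟨ permuteCode-flip ρ C ⟨
                π⁻¹ (π C)   ≈⟨ permuteCode-cong (flip ρ) (π C) D πC≈D ⟩
                π⁻¹ D       ∎)))

    StarSet-image : (ρ : Permutation′ n) {S S′ : Subset n} → IsImage ρ S S′ →
                    ∀ C → StarSet k S (permuteCode (flip ρ) C) ⇔ StarSet k S′ C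
    StarSet-image ρ (image , preimage) C = mk⇔
      (λ S⊆π⁻¹C v → code-cong C (λ j → cong v (inverseˡ ρ)) ∘ S⊆π⁻¹C _ ∘ preimage v)
      (λ S′⊆C u → S′⊆C (permuteᵛ ρ u) ∘ image u)

    IsStar-image : (ρ : Permutation′ n) {S S′ : Subset n} → IsImage ρ S S′ →
                   IsStar k S → IsStar k S′
    IsStar-image ρ image =
      IsMaximalClique-cong (StarSet-image ρ image) ∘
      IsMaximalClique-preimage ρ (λ C D C≈D S⊆D v → from (C≈D v) ∘ S⊆D v)

permuteLast : (m : ℕ) {r : ℕ} → Permutation′ r → Permutation′ (m + r)
permuteLast m σ = ↔-trans +↔⊎ (↔-trans (↔-refl ⊎-↔ σ) (↔-sym +↔⊎))

genM-permuteLast : ∀ {c ℓ q m r} (F : FiniteField c ℓ q)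
                   (A : Fin m → Fin r → FiniteField.Carrier F) (σ : Permutation′ r) (i : Fin m) →
                   LinAlg.genM F (λ i j → A i (σ ⟨$⟩ʳ j)) i ≗
                   permuteᵛ F (permuteLast m σ) (LinAlg.genM F A i)
genM-permuteLast {m = m} {r} F A σ i j = begin
  [ idRow i , A i ∘ (σ ⟨$⟩ʳ_) ] (splitAt m j)                ≡⟨ [,]-map (splitAt m j) ⟨
  [ idRow i , A i ] (columns j)                               ≡⟨ cong [ idRow i , A i ] (splitAt-join m r (columns j)) ⟨
  [ idRow i , A i ] (splitAt m (join m r (columns j)))        ∎
  where
  open ≡-Reasoning
  open LinAlg F using (idRow)
  columns : Fin (m + r) → Fin m ⊎ Fin r
  columns = Sum.map id (σ ⟨$⟩ʳ_) ∘ splitAt m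

lemma2 : ∀ {c ℓ : Level} (q : ℕ) → IsPrimePower q → (F : FiniteField c ℓ q) →
    (m r : ℕ) → 1 < suc m → suc m < (m + r) ∸ 1 →
    (A : Fin m → Fin r → FiniteField.Carrier F) →
    LinAlg.IsStar F (suc m) (LinAlg.Span F (LinAlg.genM F A)) ⇔
      (∀ (σ : Permutation′ r) →
        LinAlg.IsStar F (suc m) (LinAlg.Span F (LinAlg.genM F (λ i j → A i (σ ⟨$⟩ʳ j)))))
lemma2 q _ F m r _ _ A = mk⇔
  (λ star σ → IsStar-image F (permuteLast m σ)
                (Span-image F (permuteLast m σ) (genM-permuteLast F A σ)) star)
  (λ stars → stars Perm.id)
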